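{- Consider an FWSC instance with exactly two groups $g_1,g_2$ satisfying the standing assumptions below. Run the following algorithm: set $X_w=\emptyset$ and $U^-=U$; while $U^-\ne\emptyset$, choose, among sets not yet in $X_w$, a pair $(S_A,S_B)$ with $g(S_A)=g_1$, $g(S_B)=g_2$ minimizing $\frac{w(S_A)+w(S_B)}{|(S_A\cup S_B)\cap U^-|}$, add $S_A,S_B$ to $X_w$, and set $U^-\gets U^-\setminus(S_A\cup S_B)$; return $X_w$. Then $w(X_w)\le\Delta(\ln n+1)\,w(X_w^*)$, where $X_w^*$ is a fair cover of minimum total weight.
   Context: An FWSC instance consists of a universe $U$ of $n$ elements, a family $\mathcal{S}$ of subsets of $U$ with union $U$, groups with each set $S$ in exactly one group $g(S)$ ($\mathcal{S}_h$ = sets of group $g_h$), and a weight function $w:\mathcal{S}\to\mathbb{R}^+$, with $w(C)=\sum_{S\in C}w(S)$. A cover is a subfamily whose union is $U$; with $k$ groups a cover $X$ is fair if $|X\cap\mathcal{S}_h|=|X|/k$ for all $h$. $\Delta=w_{\max}/w_{\min}$, the ratio of maximum to minimum set weight. Standing assumptions: every group contains the same number $m$ of sets, and every group contains at least $\Omega(\Delta\log n)\cdot\frac{|X^*|}{k}$ sets, where $X^*$ denotes the optimum fair cover.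
   Formalization: The weight function $w$ takes values in the positive rationals rather than in $\mathbb{R}^+$. -}

module Defs where

open import Data.Nat as ℕ using (ℕ; zero; suc)
open import Data.Fin using (Fin)
open import Data.Fin.Subset using (Subset; _∈_; _∉_; _∪_; _∩_; _─_; ∣_∣; ⊤; ⊥; ⁅_⁆; Nonempty; Empty)
open import Data.Bool using (if_then_else_)
open import Data.Vec using (lookup)
open import Data.List using (List; foldr; map; allFin; _++_)
open import Data.Integer using (+_)
open import Data.Rational using (ℚ; 0ℚ; 1ℚ; _+_; _-_; _*_; _/_; _÷_; _≤_; _<_; _⊔_; _⊓_; ≢-nonZero)
open import Data.Rational.Properties using (_≟_)
open import Data.Product using (Σ; ∃; _×_; _,_)
open import Data.Sum using (_⊎_)
open import Relation.Nullary using (yes; no)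
open import Relation.Binary.PropositionalEquality using (_≡_)

ℕ→ℚ : ℕ → ℚ
ℕ→ℚ k = (+ k) / 1

-- total division (p / 0 := 0); only ever used with a nonzero divisor
_÷'_ : ℚ → ℚ → ℚ
p ÷' q with q ≟ 0ℚ
... | yes _ = 0ℚ
... | no q≢0 = _÷_ p q {{≢-nonZero q≢0}}

expTerm : ℚ → ℕ → ℚ
expTerm r zero = 1ℚ
expTerm r (suc k) = (expTerm r k * r) * ((+ 1) / suc k)

expPartial : ℚ → ℕ → ℚ
expPartial r zero = 0ℚ
expPartial r (suc N) = expPartial r N + expTerm r N

-- "q ≤ ln n"  (meaningful for n ≥ 1, where ln n ≥ 0):
-- either q ≤ 0, or e^q = sup_N Σ_{k<N} q^k/k! is ≤ n.
LeLn : ℚ → ℕ → Set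
LeLn q n = (q ≤ 0ℚ) ⊎ (∀ N → expPartial q N ≤ ℕ→ℚ n)

-- "ln n ≤ r"  (meaningful for n ≥ 1): r ≥ 0 and e^r ≥ n, i.e.
-- for every ε > 0 some partial sum of the series for e^r is ≥ n - ε.
LnLe : ℕ → ℚ → Set
LnLe n r = (0ℚ ≤ r) × (∀ ε → 0ℚ < ε → ∃ λ N → ℕ→ℚ n - ε ≤ expPartial r N)

-- FWSC instance with exactly two groups g₁, g₂, each containing m sets.
-- Universe U = Fin n.  Group g₁ consists of the sets A i, group g₂ of
-- the sets B i (i : Fin m); these 2m members form the family 𝒮.

record FWSC2 (n m : ℕ) : Set where
  field
    A  : Fin m → Subset n
    B  : Fin m → Subset n
    wA : Fin m → ℚ
    wB : Fin m → ℚ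
    wA-pos : ∀ i → 0ℚ < wA i
    wB-pos : ∀ i → 0ℚ < wB i
    union-U : ∀ (x : Fin n) → (∃ λ i → x ∈ A i) ⊎ (∃ λ i → x ∈ B i)

module _ {n m : ℕ} (I : FWSC2 n m) where
  open FWSC2 I

  Σfin : (Fin m → ℚ) → ℚ
  Σfin f = foldr _+_ 0ℚ (map f (allFin m))

  -- a subfamily X ⊆ 𝒮 is given by XA ⊆ g₁-indices, XB ⊆ g₂-indices
  record Subfamily : Set where
    constructor ⟨_,_⟩
    field
      XA : Subset m
      XB : Subset m
  open Subfamily public

  weight : Subfamily → ℚ
  weight X = Σfin (λ i → if lookup (XA X) i then wA i else 0ℚ)
           + Σfin (λ i → if lookup (XB X) i then wB i else 0ℚ)

  size : Subfamily → ℕ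
  size X = ∣ XA X ∣ ℕ.+ ∣ XB X ∣

  IsCover : Subfamily → Set
  IsCover X = ∀ (x : Fin n) →
    (∃ λ i → i ∈ XA X × x ∈ A i) ⊎ (∃ λ i → i ∈ XB X × x ∈ B i)

  -- X is fair (k = 2): |X ∩ 𝒮_h| = |X|/2 for h = 1,2
  IsFair : Subfamily → Set
  IsFair X = (2 ℕ.* ∣ XA X ∣ ≡ size X) × (2 ℕ.* ∣ XB X ∣ ≡ size X)

  IsFairCover : Subfamily → Set
  IsFairCover X = IsCover X × IsFair X

  IsOptFairCover : Subfamily → Set
  IsOptFairCover X = IsFairCover X × (∀ Y → IsFairCover Y → weight X ≤ weight Y)

  allWeights : List ℚ
  allWeights = map wA (allFin m) ++ map wB (allFin m)

  wmax : ℚ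
  wmax = foldr _⊔_ 0ℚ allWeights   -- weights are positive, so 0 is neutral

  wmin : ℚ
  wmin = foldr _⊓_ wmax allWeights  -- wmax ≥ every weight, so it is neutral

  Δ : ℚ
  Δ = wmax ÷' wmin

  record State : Set where
    constructor st
    field
      Xw : Subfamily
      Um : Subset n
  open State public

  newCov : Subset n → Fin m → Fin m → ℚ
  newCov U⁻ i j = ℕ→ℚ ∣ (A i ∪ B j) ∩ U⁻ ∣

  -- One iteration of the while loop (only when U⁻ ≠ ∅): choose a pair
  -- (A i, B j) of sets not yet in X_w minimising
  --   (w(A i) + w(B j)) / |(A i ∪ B j) ∩ U⁻|
  -- (ratio compared by cross-multiplication; a zero denominator counts as
  -- +∞), add both sets to X_w and remove A i ∪ B j from U⁻.
  data Step : State → State → Set where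
    step : ∀ XA₀ XB₀ U⁻ i j →
      Nonempty U⁻ →
      i ∉ XA₀ → j ∉ XB₀ →
      (∀ i' j' → i' ∉ XA₀ → j' ∉ XB₀ →
         (wA i + wB j) * newCov U⁻ i' j' ≤ (wA i' + wB j') * newCov U⁻ i j) →
      Step (st ⟨ XA₀ , XB₀ ⟩ U⁻)
           (st ⟨ XA₀ ∪ ⁅ i ⁆ ,
                 XB₀ ∪ ⁅ j ⁆ ⟩
               (U⁻ ─ (A i ∪ B j)))

  data Steps : State → State → Set where
    done : ∀ s → Steps s s
    more : ∀ {s t u} → Step s t → Steps t u → Steps s u

  -- X is a possible output of the algorithm (for some tie-breaking):
  -- starting from X_w = ∅, U⁻ = U, the loop runs until U⁻ = ∅.
  GreedyOutput : Subfamily → Set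
  GreedyOutput X = ∃ λ U⁻ →
    Steps (st ⟨ ⊥ , ⊥ ⟩ ⊤) (st X U⁻) × Empty U⁻

{-# OPTIONS --safe #-}

-- Let u and u′ be the numbers of uncovered elements before and after a greedy step.  Pair up the
-- sets of the optimal fair cover X* (|X*|/2 pairs, one set from each group) and replace every set
-- already in X_w by the set of the same group just chosen: a replaced set covers no uncovered
-- element, so this gives eligible pairs that still cover U⁻, each of weight at most 2 wmax.  As the
-- chosen pair minimises weight per newly covered element, it weighs at most
-- |X*| wmax (u - u′) / u ≤ Δ w(X*) (H u - H u′), with H the harmonic numbers.  Telescoping gives
-- w(X_w) ≤ Δ w(X*) H n, and H n - 1 ≤ ln n, i.e. e^(H n - 1) ≤ n, is proved on the partial sums
-- of the exponential series.
module Submission where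

open import Defs

open import Data.Bool using (true; false; if_then_else_; _∨_)
open import Data.Bool.Properties using (∨-identityʳ)
open import Data.Empty using (⊥-elim)
open import Data.Fin using (Fin; zero; suc)
open import Data.Fin.Subset
  using (Subset; _∈_; _∉_; _⊆_; _∪_; _∩_; _─_; ∣_∣; ⊤; ⊥; ⁅_⁆; Nonempty; Empty)
open import Data.Fin.Subset.Properties
  using ( _∈?_; Empty-unique; ∉⊥; ∣⊥∣≡0; ∣⊤∣≡n; ∣p∣≤∣x∷p∣; x∈⁅y⁆⇒x≡y; p⊆q⇒∣p∣≤∣q∣; ⊆-refl; p─q⊆p
        ; x∈p∩q⁺; x∈p∩q⁻; x∈p∪q⁺; x∈p∪q⁻; ∪-identityʳ)
open import Data.Integer as ℤ using (+_)
import Data.Integer.Properties as ℤ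
open import Data.List as List using (List; []; _∷_)
open import Data.List.Membership.Propositional using (lose) renaming (_∈_ to _∈ₗ_)
open import Data.List.Membership.Propositional.Properties using (∈-map⁺; ∈-++⁺ˡ; ∈-++⁺ʳ; ∈-allFin)
open import Data.List.Properties
  using (map-tabulate; length-map; length-zipWith; foldr-preservesᵇ; foldr-preservesᵒ)
open import Data.List.Relation.Unary.All using (All)
import Data.List.Relation.Unary.All.Properties as All
open import Data.List.Relation.Unary.Any as Any using (Any; here; there)
open import Data.Nat using (ℕ; zero; suc; 2+)
import Data.Nat as ℕ
import Data.Nat.Coprimality as Coprimality
open import Data.Nat.ListAction using (sum)
import Data.Nat.Properties as ℕP
open import Data.Product as Product using (Σ; ∃; _×_; _,_; proj₁; proj₂)
open import Data.Rational
  using (ℚ; 0ℚ; 1ℚ; _+_; _-_; _*_; _/_; _≤_; _<_; _⊔_; _⊓_; -_; 1/_; mkℚ; nonNegative; positive; ≢-nonZero)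
open import Data.Rational.Properties
open import Algebra.Properties.Monoid.Sum +-0-monoid using () renaming (sum to ∑)
open import Data.Rational.Solver using (module +-*-Solver)
open import Data.Sum using (inj₁; inj₂; [_,_]′)
open import Data.Vec using ([]; _∷_; here; there; lookup)
open import Function using (_∘_; id)
open import Relation.Binary.PropositionalEquality
open import Relation.Nullary using (¬_; yes; no)

open +-*-Solver using (solve; _:=_; _:+_; _:*_; _:-_; con)

p≤p+q : ∀ p {q} → 0ℚ ≤ q → p ≤ p + q
p≤p+q p {q} 0≤q = ≤-trans (≤-reflexive (sym (+-identityʳ p))) (+-monoʳ-≤ p 0≤q)

*-nonNeg : ∀ {p q} → 0ℚ ≤ p → 0ℚ ≤ q → 0ℚ ≤ p * q
*-nonNeg {p} 0≤p 0≤q =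
  ≤-trans (≤-reflexive (sym (*-zeroʳ p))) (*-monoˡ-≤-nonNeg p {{nonNegative 0≤p}} 0≤q)

ℕ→ℚ≡mkℚ : ∀ k → ℕ→ℚ k ≡ mkℚ (+ k) 0 (Coprimality.sym (Coprimality.1-coprimeTo k))
ℕ→ℚ≡mkℚ k = normalize-coprime _

ℕ→ℚ-+ : ∀ a b → ℕ→ℚ (a ℕ.+ b) ≡ ℕ→ℚ a + ℕ→ℚ b
ℕ→ℚ-+ a b rewrite ℕ→ℚ≡mkℚ a | ℕ→ℚ≡mkℚ b =
  trans (ℕ→ℚ≡mkℚ (a ℕ.+ b)) (trans (sym (normalize-coprime _)) (/-cong numerators refl))
  where
  numerators : + (a ℕ.+ b) ≡ + a ℤ.* + 1 ℤ.+ + b ℤ.* + 1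
  numerators = trans (ℤ.pos-+ a b) (sym (cong₂ ℤ._+_ (ℤ.*-identityʳ (+ a)) (ℤ.*-identityʳ (+ b))))

ℕ→ℚ-suc : ∀ k → ℕ→ℚ (suc k) ≡ 1ℚ + ℕ→ℚ k
ℕ→ℚ-suc = ℕ→ℚ-+ 1

0≤ℕ→ℚ : ∀ k → 0ℚ ≤ ℕ→ℚ k
0≤ℕ→ℚ k = nonNegative⁻¹ _ {{normalize-nonNeg k 1}}

0<ℕ→ℚ-suc : ∀ k → 0ℚ < ℕ→ℚ (suc k)
0<ℕ→ℚ-suc k = positive⁻¹ _ {{normalize-pos (suc k) 1}}

ℕ→ℚ-mono-≤ : ∀ {a b} → a ℕ.≤ b → ℕ→ℚ a ≤ ℕ→ℚ b
ℕ→ℚ-mono-≤ {a} {b} a≤b = begin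
  ℕ→ℚ a                       ≤⟨ p≤p+q (ℕ→ℚ a) (0≤ℕ→ℚ (b ℕ.∸ a)) ⟩
  ℕ→ℚ a + ℕ→ℚ (b ℕ.∸ a)       ≡⟨ sym (ℕ→ℚ-+ a (b ℕ.∸ a)) ⟩
  ℕ→ℚ (a ℕ.+ (b ℕ.∸ a))       ≡⟨ cong ℕ→ℚ (ℕP.m+[n∸m]≡n a≤b) ⟩
  ℕ→ℚ b                       ∎
  where open ≤-Reasoning

p≤ℕ→ℚ[k]*p : ∀ {k p} → 0 ℕ.< k → 0ℚ ≤ p → p ≤ ℕ→ℚ k * p
p≤ℕ→ℚ[k]*p {k} {p} 0<k 0≤p =
  ≤-trans (≤-reflexive (sym (*-identityˡ p)))
          (*-monoʳ-≤-nonNeg p {{nonNegative 0≤p}} (ℕ→ℚ-mono-≤ 0<k))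

ℕ→ℚ-*-reciprocal : ∀ k → ℕ→ℚ (suc k) * (+ 1 / suc k) ≡ 1ℚ
ℕ→ℚ-*-reciprocal k =
  trans (cong₂ _*_ (ℕ→ℚ≡mkℚ (suc k)) (normalize-coprime (Coprimality.1-coprimeTo (suc k))))
        (*-inverseʳ (mkℚ (+ suc k) 0 (Coprimality.sym (Coprimality.1-coprimeTo (suc k)))))

0≤1/[1+k] : ∀ k → 0ℚ ≤ + 1 / suc k
0≤1/[1+k] k = nonNegative⁻¹ _ {{normalize-nonNeg 1 (suc k)}}

÷'-*-cancel : ∀ p {q} → 0ℚ < q → (p ÷' q) * q ≡ p
÷'-*-cancel p {q} 0<q with q ≟ 0ℚ
... | yes q≡0 = ⊥-elim (<-irrefl (sym q≡0) 0<q)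
... | no  q≢0 = trans (*-assoc p (1/ q) q) (trans (cong (p *_) (*-inverseˡ q)) (*-identityʳ p))
  where instance _ = ≢-nonZero q≢0

÷'-≤ : ∀ {p q r} → 0ℚ < q → p ≤ q * r → p ÷' q ≤ r
÷'-≤ {p} {q} {r} 0<q p≤qr = *-cancelʳ-≤-pos q {{positive 0<q}} (begin
  (p ÷' q) * q  ≡⟨ ÷'-*-cancel p 0<q ⟩
  p             ≤⟨ p≤qr ⟩
  q * r         ≡⟨ *-comm q r ⟩
  r * q         ∎)
  where open ≤-Reasoning

∈⇒≤foldr-⊔ : ∀ {x} z xs → x ∈ₗ xs → x ≤ List.foldr _⊔_ z xs
∈⇒≤foldr-⊔ z xs x∈xs = foldr-preservesᵒ (λ p q → [ p≤q⇒p≤q⊔r q , p≤q⇒p≤r⊔q p ]′) z xs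
                         (inj₂ (Any.map (λ { refl → ≤-refl }) x∈xs))

∈⇒foldr-⊓≤ : ∀ {x} z xs → x ∈ₗ xs → List.foldr _⊓_ z xs ≤ x
∈⇒foldr-⊓≤ z xs x∈xs = foldr-preservesᵒ (λ p q → [ p≤q⇒p⊓r≤q q , p≤q⇒r⊓p≤q p ]′) z xs
                         (inj₂ (Any.map (λ { refl → ≤-refl }) x∈xs))

0<foldr-⊓ : ∀ {z xs} → 0ℚ < z → All (0ℚ <_) xs → 0ℚ < List.foldr _⊓_ z xs
0<foldr-⊓ = foldr-preservesᵇ 0<⊓
  where
  0<⊓ : ∀ {p q} → 0ℚ < p → 0ℚ < q → 0ℚ < p ⊓ q
  0<⊓ {p} {q} 0<p 0<q = [ (λ p⊓q≡p → subst (0ℚ <_) (sym p⊓q≡p) 0<p)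
                        , (λ p⊓q≡q → subst (0ℚ <_) (sym p⊓q≡q) 0<q) ]′ (⊓-sel p q)

expTerm-nonNeg : ∀ {x} → 0ℚ ≤ x → ∀ k → 0ℚ ≤ expTerm x k
expTerm-nonNeg 0≤x zero    = nonNegative⁻¹ 1ℚ
expTerm-nonNeg 0≤x (suc k) = *-nonNeg (*-nonNeg (expTerm-nonNeg 0≤x k) 0≤x) (0≤1/[1+k] k)

expTerm-mono-≤ : ∀ {x y} → 0ℚ ≤ x → x ≤ y → ∀ k → expTerm x k ≤ expTerm y k
expTerm-mono-≤ 0≤x x≤y zero = ≤-refl
expTerm-mono-≤ {x} {y} 0≤x x≤y (suc k) =
  *-monoʳ-≤-nonNeg (+ 1 / suc k) {{nonNegative (0≤1/[1+k] k)}}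
    (≤-trans (*-monoʳ-≤-nonNeg x {{nonNegative 0≤x}} (expTerm-mono-≤ 0≤x x≤y k))
             (*-monoˡ-≤-nonNeg (expTerm y k) {{nonNegative (expTerm-nonNeg (≤-trans 0≤x x≤y) k)}} x≤y))

expPartial-mono-≤ : ∀ {x y} → 0ℚ ≤ x → x ≤ y → ∀ N → expPartial x N ≤ expPartial y N
expPartial-mono-≤ 0≤x x≤y zero    = ≤-refl
expPartial-mono-≤ 0≤x x≤y (suc N) =
  +-mono-≤ (expPartial-mono-≤ 0≤x x≤y N) (expTerm-mono-≤ 0≤x x≤y N)

expTerm-0-suc : ∀ k → expTerm 0ℚ (suc k) ≡ 0ℚ
expTerm-0-suc k = trans (cong (_* (+ 1 / suc k)) (*-zeroʳ (expTerm 0ℚ k))) (*-zeroˡ (+ 1 / suc k))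

expPartial-0≤1 : ∀ N → expPartial 0ℚ N ≤ 1ℚ
expPartial-0≤1 zero    = nonNegative⁻¹ 1ℚ
expPartial-0≤1 (suc N) = ≤-reflexive (expPartial-0-suc N)
  where
  expPartial-0-suc : ∀ N → expPartial 0ℚ (suc N) ≡ 1ℚ
  expPartial-0-suc zero    = refl
  expPartial-0-suc (suc N) =
    trans (cong₂ _+_ (expPartial-0-suc N) (expTerm-0-suc N)) (+-identityʳ 1ℚ)

*-expTerm : ∀ x k → x * expTerm x k ≡ ℕ→ℚ (suc k) * expTerm x (suc k)
*-expTerm x k = begin
  x * t                ≡⟨ solve 2 (λ x t → x :* t := (t :* x) :* con 1ℚ) refl x t ⟩
  (t * x) * 1ℚ         ≡⟨ cong ((t * x) *_) (sym (ℕ→ℚ-*-reciprocal k)) ⟩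
  (t * x) * (c * r)    ≡⟨ solve 4 (λ t x c r → (t :* x) :* (c :* r) := c :* ((t :* x) :* r)) refl t x c r ⟩
  c * ((t * x) * r)    ∎
  where
  open ≡-Reasoning
  t = expTerm x k
  c = ℕ→ℚ (suc k)
  r = + 1 / suc k

-- Discrete mean value inequality: (x + y)^(k+1) - x^(k+1) ≤ (k + 1) y (x + y)^k, divided by (k + 1)!.
expTerm-+-suc : ∀ {x y} → 0ℚ ≤ x → 0ℚ ≤ y → ∀ k →
                expTerm (x + y) (suc k) ≤ expTerm x (suc k) + y * expTerm (x + y) k
expTerm-+-suc {x} {y} _ _ zero = ≤-reflexive
  (solve 2 (λ x y → (con 1ℚ :* (x :+ y)) :* con 1ℚ := (con 1ℚ :* x) :* con 1ℚ :+ y :* con 1ℚ) refl x y)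
expTerm-+-suc {x} {y} 0≤x 0≤y (suc k) = *-cancelˡ-≤-pos c {{positive (0<ℕ→ℚ-suc (suc k))}} (begin
  c * T z (2+ k)
    ≡⟨ sym (*-expTerm z (suc k)) ⟩
  z * T z (suc k)
    ≡⟨ *-distribʳ-+ (T z (suc k)) x y ⟩
  x * T z (suc k) + y * T z (suc k)
    ≤⟨ +-monoˡ-≤ (y * T z (suc k)) (*-monoˡ-≤-nonNeg x {{nonNegative 0≤x}} (expTerm-+-suc 0≤x 0≤y k)) ⟩
  x * (T x (suc k) + y * T z k) + y * T z (suc k)
    ≡⟨ solve 5 (λ x y a b t → x :* (a :+ y :* b) :+ y :* t := x :* a :+ y :* (x :* b) :+ y :* t)
               refl x y (T x (suc k)) (T z k) (T z (suc k)) ⟩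
  x * T x (suc k) + y * (x * T z k) + y * T z (suc k)
    ≤⟨ +-monoˡ-≤ (y * T z (suc k)) (+-monoʳ-≤ (x * T x (suc k)) (*-monoˡ-≤-nonNeg y {{nonNegative 0≤y}} x*Tzk≤z*Tzk)) ⟩
  x * T x (suc k) + y * (z * T z k) + y * T z (suc k)
    ≡⟨ cong₂ (λ a b → a + y * b + y * T z (suc k)) (*-expTerm x (suc k)) (*-expTerm z k) ⟩
  c * T x (2+ k) + y * (c′ * T z (suc k)) + y * T z (suc k)
    ≡⟨ cong (λ c → c * T x (2+ k) + y * (c′ * T z (suc k)) + y * T z (suc k)) (ℕ→ℚ-suc (suc k)) ⟩
  (1ℚ + c′) * T x (2+ k) + y * (c′ * T z (suc k)) + y * T z (suc k)
    ≡⟨ solve 4 (λ c′ a y t → (con 1ℚ :+ c′) :* a :+ y :* (c′ :* t) :+ y :* t := (con 1ℚ :+ c′) :* (a :+ y :* t))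
               refl c′ (T x (2+ k)) y (T z (suc k)) ⟩
  (1ℚ + c′) * (T x (2+ k) + y * T z (suc k))
    ≡⟨ cong (_* (T x (2+ k) + y * T z (suc k))) (sym (ℕ→ℚ-suc (suc k))) ⟩
  c * (T x (2+ k) + y * T z (suc k))
    ∎)
  where
  open ≤-Reasoning
  T = expTerm
  z = x + y
  c = ℕ→ℚ (2+ k)
  c′ = ℕ→ℚ (suc k)
  x*Tzk≤z*Tzk : x * T z k ≤ z * T z k
  x*Tzk≤z*Tzk = *-monoʳ-≤-nonNeg (T z k) {{nonNegative (expTerm-nonNeg (+-mono-≤ 0≤x 0≤y) k)}} (p≤p+q x 0≤y)

expPartial-+-suc : ∀ {x y} → 0ℚ ≤ x → 0ℚ ≤ y → ∀ N →
                   expPartial (x + y) (suc N) ≤ expPartial x (suc N) + y * expPartial (x + y) N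
expPartial-+-suc {x} {y} _ _ zero =
  ≤-reflexive (sym (trans (cong (λ q → expPartial x 1 + q) (*-zeroʳ y)) (+-identityʳ _)))
expPartial-+-suc {x} {y} 0≤x 0≤y (suc N) = begin
  E z (suc N) + T z (suc N)
    ≤⟨ +-mono-≤ (expPartial-+-suc 0≤x 0≤y N) (expTerm-+-suc 0≤x 0≤y N) ⟩
  (E x (suc N) + y * E z N) + (T x (suc N) + y * T z N)
    ≡⟨ solve 5 (λ a y b c d → (a :+ y :* b) :+ (c :+ y :* d) := (a :+ c) :+ y :* (b :+ d))
               refl (E x (suc N)) y (E z N) (T x (suc N)) (T z N) ⟩
  E x (2+ N) + y * E z (suc N)
    ∎
  where
  open ≤-Reasoning
  E = expPartial
  T = expTerm
  z = x + y

expPartial-+ : ∀ {x y} → 0ℚ ≤ x → 0ℚ ≤ y → ∀ N →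
               expPartial (x + y) N ≤ expPartial x N + y * expPartial (x + y) N
expPartial-+ {x} {y} _ _ zero =
  ≤-reflexive (sym (trans (cong (λ q → 0ℚ + q) (*-zeroʳ y)) (+-identityʳ 0ℚ)))
expPartial-+ {x} {y} 0≤x 0≤y (suc N) =
  ≤-trans (expPartial-+-suc 0≤x 0≤y N)
          (+-monoʳ-≤ (expPartial x (suc N)) (*-monoˡ-≤-nonNeg y {{nonNegative 0≤y}}
            (p≤p+q (expPartial (x + y) N) (expTerm-nonNeg (+-mono-≤ 0≤x 0≤y) N))))

harmonic : ℕ → ℚ
harmonic zero    = 0ℚ
harmonic (suc n) = harmonic n + + 1 / suc n

harmonic-mono-≤ : ∀ d v → harmonic v ≤ harmonic (d ℕ.+ v)
harmonic-mono-≤ zero    v = ≤-refl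
harmonic-mono-≤ (suc d) v =
  ≤-trans (harmonic-mono-≤ d v) (p≤p+q (harmonic (d ℕ.+ v)) (0≤1/[1+k] (d ℕ.+ v)))

-- H (d + v) - H v is a sum of d terms, each at least 1 / (d + v).
harmonic-gap : ∀ d v → ℕ→ℚ d ≤ ℕ→ℚ (d ℕ.+ v) * (harmonic (d ℕ.+ v) - harmonic v)
harmonic-gap zero v =
  ≤-reflexive (sym (trans (cong (ℕ→ℚ v *_) (+-inverseʳ (harmonic v))) (*-zeroʳ (ℕ→ℚ v))))
harmonic-gap (suc d) v = begin
  ℕ→ℚ (suc d)                  ≡⟨ ℕ→ℚ-suc d ⟩
  1ℚ + ℕ→ℚ d                   ≤⟨ +-monoʳ-≤ 1ℚ (harmonic-gap d v) ⟩
  1ℚ + c * δ                   ≤⟨ +-monoʳ-≤ 1ℚ (p≤p+q (c * δ) 0≤δ) ⟩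
  1ℚ + (c * δ + δ)             ≡⟨ cong (λ q → q + (c * δ + δ)) (sym (ℕ→ℚ-*-reciprocal (d ℕ.+ v))) ⟩
  c′ * r + (c * δ + δ)         ≡⟨ cong (λ q → q * r + (c * δ + δ)) (ℕ→ℚ-suc (d ℕ.+ v)) ⟩
  (1ℚ + c) * r + (c * δ + δ)   ≡⟨ solve 3 (λ c r δ → (con 1ℚ :+ c) :* r :+ (c :* δ :+ δ) := (con 1ℚ :+ c) :* (δ :+ r))
                                          refl c r δ ⟩
  (1ℚ + c) * (δ + r)           ≡⟨ cong₂ _*_ (sym (ℕ→ℚ-suc (d ℕ.+ v)))
                                            (solve 3 (λ a b r → (a :- b) :+ r := a :+ r :- b) refl H H′ r) ⟩
  c′ * (harmonic (suc d ℕ.+ v) - H′) ∎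
  where
  open ≤-Reasoning
  H = harmonic (d ℕ.+ v)
  H′ = harmonic v
  c = ℕ→ℚ (d ℕ.+ v)
  c′ = ℕ→ℚ (suc (d ℕ.+ v))
  r = + 1 / suc (d ℕ.+ v)
  δ = H - H′
  0≤δ : 0ℚ ≤ δ
  0≤δ = ≤-trans (≤-reflexive (sym (+-inverseʳ H′))) (+-monoˡ-≤ (- H′) (harmonic-mono-≤ d v))

-- With y = 1 / (n + 2), expPartial-+ gives (1 - y) e^(H (n + 2) - 1) ≤ e^(H (n + 1) - 1) ≤ n + 1,
-- and (n + 1) / (1 - y) = n + 2.
expPartial-harmonic-≤ : ∀ n N → expPartial (harmonic (suc n) - 1ℚ) N ≤ ℕ→ℚ (suc n)
expPartial-harmonic-≤ zero    N = expPartial-0≤1 N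
expPartial-harmonic-≤ (suc n) N = subst (λ q → expPartial q N ≤ c′) (sym H-1≡x+y)
  (*-cancelˡ-≤-pos c {{positive (0<ℕ→ℚ-suc n)}} (begin
    c * E             ≡⟨ c*E≡c′*[E-yE] ⟩
    c′ * (E - y * E)  ≤⟨ *-monoˡ-≤-nonNeg c′ {{nonNegative (0≤ℕ→ℚ (2+ n))}} E-yE≤c ⟩
    c′ * c            ≡⟨ *-comm c′ c ⟩
    c * c′            ∎))
  where
  open ≤-Reasoning
  x = harmonic (suc n) - 1ℚ
  y = + 1 / 2+ n
  c = ℕ→ℚ (suc n)
  c′ = ℕ→ℚ (2+ n)
  E = expPartial (x + y) N
  H-1≡x+y : harmonic (2+ n) - 1ℚ ≡ x + y
  H-1≡x+y = solve 3 (λ h y o → h :+ y :- o := h :- o :+ y) refl (harmonic (suc n)) y 1ℚ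
  0≤x : 0ℚ ≤ x
  0≤x = ≤-trans (≤-reflexive (sym (+-inverseʳ 1ℚ)))
                (+-monoˡ-≤ (- 1ℚ) (subst (λ k → 1ℚ ≤ harmonic k) (ℕP.+-comm n 1) (harmonic-mono-≤ n 1)))
  E-yE≤c : E - y * E ≤ c
  E-yE≤c = begin
    E - y * E          ≤⟨ +-monoˡ-≤ (- (y * E)) (expPartial-+ 0≤x (0≤1/[1+k] (suc n)) N) ⟩
    E′ + y * E - y * E ≡⟨ solve 2 (λ e z → e :+ z :- z := e) refl E′ (y * E) ⟩
    E′                 ≤⟨ expPartial-harmonic-≤ n N ⟩
    c                  ∎
    where E′ = expPartial x N
  c*E≡c′*[E-yE] : c * E ≡ c′ * (E - y * E)
  c*E≡c′*[E-yE] = begin-equality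
    c * E
      ≡⟨ solve 3 (λ c y e → c :* e := (con 1ℚ :+ c) :* (e :- y :* e) :+ ((con 1ℚ :+ c) :* y :- con 1ℚ) :* e)
                 refl c y E ⟩
    (1ℚ + c) * (E - y * E) + ((1ℚ + c) * y - 1ℚ) * E
      ≡⟨ cong (λ q → q * (E - y * E) + (q * y - 1ℚ) * E) (sym (ℕ→ℚ-suc (suc n))) ⟩
    c′ * (E - y * E) + (c′ * y - 1ℚ) * E
      ≡⟨ cong (λ q → c′ * (E - y * E) + (q - 1ℚ) * E) (ℕ→ℚ-*-reciprocal (suc n)) ⟩
    c′ * (E - y * E) + (1ℚ - 1ℚ) * E
      ≡⟨ solve 3 (λ c e f → c :* f :+ (con 1ℚ :- con 1ℚ) :* e := c :* f) refl c′ E (E - y * E) ⟩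
    c′ * (E - y * E)
      ∎

≤harmonic-1⇒LeLn : ∀ {q} n → q ≤ harmonic (suc n) - 1ℚ → LeLn q (suc n)
≤harmonic-1⇒LeLn {q} n q≤H-1 with q ≤? 0ℚ
... | yes q≤0 = inj₁ q≤0
... | no  q≰0 = inj₂ λ N →
  ≤-trans (expPartial-mono-≤ (<⇒≤ (≰⇒> q≰0)) q≤H-1 N) (expPartial-harmonic-≤ n N)

x∈p─q⇒x∉q : ∀ {n} {x : Fin n} (p q : Subset n) → x ∈ p ─ q → x ∉ q
x∈p─q⇒x∉q (_ ∷ p) (true  ∷ q) (there x∈p─q) (there x∈q) = x∈p─q⇒x∉q p q x∈p─q x∈q
x∈p─q⇒x∉q (_ ∷ p) (false ∷ q) (there x∈p─q) (there x∈q) = x∈p─q⇒x∉q p q x∈p─q x∈q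

∣q∩p∣+∣p─q∣≡∣p∣ : ∀ {n} (p q : Subset n) → ∣ q ∩ p ∣ ℕ.+ ∣ p ─ q ∣ ≡ ∣ p ∣
∣q∩p∣+∣p─q∣≡∣p∣ []          []          = refl
∣q∩p∣+∣p─q∣≡∣p∣ (true  ∷ p) (true  ∷ q) = cong suc (∣q∩p∣+∣p─q∣≡∣p∣ p q)
∣q∩p∣+∣p─q∣≡∣p∣ (true  ∷ p) (false ∷ q) =
  trans (ℕP.+-suc ∣ q ∩ p ∣ ∣ p ─ q ∣) (cong suc (∣q∩p∣+∣p─q∣≡∣p∣ p q))
∣q∩p∣+∣p─q∣≡∣p∣ (false ∷ p) (true  ∷ q) = ∣q∩p∣+∣p─q∣≡∣p∣ p q
∣q∩p∣+∣p─q∣≡∣p∣ (false ∷ p) (false ∷ q) = ∣q∩p∣+∣p─q∣≡∣p∣ p q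

Empty⇒∣p∣≡0 : ∀ {n} {p : Subset n} → Empty p → ∣ p ∣ ≡ 0
Empty⇒∣p∣≡0 {n} p-empty = trans (cong ∣_∣ (Empty-unique p-empty)) (∣⊥∣≡0 n)

x∈p⇒0<∣p∣ : ∀ {n} {x : Fin n} {p : Subset n} → x ∈ p → 0 ℕ.< ∣ p ∣
x∈p⇒0<∣p∣ here = ℕ.z<s
x∈p⇒0<∣p∣ {p = b ∷ p} (there x∈p) = ℕP.<-≤-trans (x∈p⇒0<∣p∣ x∈p) (∣p∣≤∣x∷p∣ b p)

-- Generalised to p ⊆ q so that the induction can shrink p while the summands stay fixed.
union-bound : ∀ {n} {X : Set} (F : X → Subset n) (L : List X) {p q : Subset n} → p ⊆ q →
              (∀ {x} → x ∈ p → Any (λ e → x ∈ F e) L) →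
              ∣ p ∣ ℕ.≤ sum (List.map (λ e → ∣ F e ∩ q ∣) L)
union-bound F [] p⊆q covered =
  ℕP.≤-reflexive (Empty⇒∣p∣≡0 (λ { (_ , x∈p) → uncovered (covered x∈p) }))
  where
  uncovered : ∀ {x} → ¬ Any (λ e → x ∈ F e) []
  uncovered ()
union-bound F (e ∷ L) {p} {q} p⊆q covered = begin
  ∣ p ∣
    ≡⟨ sym (∣q∩p∣+∣p─q∣≡∣p∣ p (F e)) ⟩
  ∣ F e ∩ p ∣ ℕ.+ ∣ p ─ F e ∣
    ≤⟨ ℕP.+-mono-≤ (p⊆q⇒∣p∣≤∣q∣ Fe∩p⊆Fe∩q) (union-bound F L (p⊆q ∘ p─q⊆p p (F e)) covered-by-L) ⟩
  sum (List.map (λ e → ∣ F e ∩ q ∣) (e ∷ L))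
    ∎
  where
  open ℕP.≤-Reasoning
  Fe∩p⊆Fe∩q : F e ∩ p ⊆ F e ∩ q
  Fe∩p⊆Fe∩q x∈ with x∈p∩q⁻ (F e) p x∈
  ... | x∈Fe , x∈p = x∈p∩q⁺ (x∈Fe , p⊆q x∈p)
  covered-by-L : ∀ {x} → x ∈ p ─ F e → Any (λ e → x ∈ F e) L
  covered-by-L x∈p─Fe with covered (p─q⊆p p (F e) x∈p─Fe)
  ... | here x∈Fe  = ⊥-elim (x∈p─q⇒x∉q p (F e) x∈p─Fe x∈Fe)
  ... | there x∈FL = x∈FL

*-sum≤length* : ∀ {X : Set} (c M : ℚ) (g : X → ℕ) (L : List X) → (∀ e → c * ℕ→ℚ (g e) ≤ M) →
                c * ℕ→ℚ (sum (List.map g L)) ≤ ℕ→ℚ (List.length L) * M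
*-sum≤length* c M g [] _ = ≤-reflexive (trans (*-zeroʳ c) (sym (*-zeroˡ M)))
*-sum≤length* c M g (e ∷ L) bound = begin
  c * ℕ→ℚ (g e ℕ.+ S)        ≡⟨ trans (cong (c *_) (ℕ→ℚ-+ (g e) S)) (*-distribˡ-+ c (ℕ→ℚ (g e)) (ℕ→ℚ S)) ⟩
  c * ℕ→ℚ (g e) + c * ℕ→ℚ S  ≤⟨ +-mono-≤ (bound e) (*-sum≤length* c M g L bound) ⟩
  M + ℓ * M                  ≡⟨ solve 2 (λ M l → M :+ l :* M := (con 1ℚ :+ l) :* M) refl M ℓ ⟩
  (1ℚ + ℓ) * M               ≡⟨ cong (_* M) (sym (ℕ→ℚ-suc (List.length L))) ⟩
  ℕ→ℚ (suc (List.length L)) * M ∎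
  where
  open ≤-Reasoning
  S = sum (List.map g L)
  ℓ = ℕ→ℚ (List.length L)

elements : ∀ {m} → Subset m → List (Fin m)
elements []          = []
elements (true  ∷ p) = zero ∷ List.map suc (elements p)
elements (false ∷ p) = List.map suc (elements p)

length-elements : ∀ {m} (p : Subset m) → List.length (elements p) ≡ ∣ p ∣
length-elements []          = refl
length-elements (true  ∷ p) = cong suc (trans (length-map suc (elements p)) (length-elements p))
length-elements (false ∷ p) = trans (length-map suc (elements p)) (length-elements p)

∈-elements : ∀ {m} {k : Fin m} (p : Subset m) → k ∈ p → k ∈ₗ elements p
∈-elements (true  ∷ p) here         = here refl
∈-elements (true  ∷ p) (there k∈p) = there (∈-map⁺ suc (∈-elements p k∈p))
∈-elements (false ∷ p) (there k∈p) = ∈-map⁺ suc (∈-elements p k∈p)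

∈-zip⁺ˡ : ∀ {A B : Set} {x : A} (xs : List A) (ys : List B) → List.length xs ≡ List.length ys →
          x ∈ₗ xs → ∃ λ y → (x , y) ∈ₗ List.zip xs ys
∈-zip⁺ˡ (_ ∷ xs) (y ∷ ys) _  (here refl)  = y , here refl
∈-zip⁺ˡ (_ ∷ xs) (_ ∷ ys) eq (there x∈xs) =
  Product.map₂ there (∈-zip⁺ˡ xs ys (ℕP.suc-injective eq) x∈xs)

∈-zip⁺ʳ : ∀ {A B : Set} {y : B} (xs : List A) (ys : List B) → List.length xs ≡ List.length ys →
          y ∈ₗ ys → ∃ λ x → (x , y) ∈ₗ List.zip xs ys
∈-zip⁺ʳ (x ∷ xs) (_ ∷ ys) _  (here refl)  = x , here refl
∈-zip⁺ʳ (_ ∷ xs) (_ ∷ ys) eq (there y∈ys) =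
  Product.map₂ there (∈-zip⁺ʳ xs ys (ℕP.suc-injective eq) y∈ys)

replaceIn : ∀ {m} → Subset m → Fin m → Fin m → Fin m
replaceIn p i k with k ∈? p
... | yes _ = i
... | no  _ = k

replaceIn-∉ : ∀ {m} {p : Subset m} {i} k → i ∉ p → replaceIn p i k ∉ p
replaceIn-∉ {p = p} k i∉p with k ∈? p
... | yes _   = i∉p
... | no  k∉p = k∉p

replaceIn-fix : ∀ {m} {p : Subset m} {i k} → k ∉ p → replaceIn p i k ≡ k
replaceIn-fix {p = p} {k = k} k∉p with k ∈? p
... | yes k∈p = ⊥-elim (k∉p k∈p)
... | no  _   = refl

foldr-tabulate : ∀ {m} (f : Fin m → ℚ) → List.foldr _+_ 0ℚ (List.tabulate f) ≡ ∑ f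
foldr-tabulate {zero}  f = refl
foldr-tabulate {suc m} f = cong (λ q → f zero + q) (foldr-tabulate (f ∘ suc))

Σfin≡∑ : ∀ {n m} (I : FWSC2 n m) (f : Fin m → ℚ) → Σfin I f ≡ ∑ f
Σfin≡∑ I f = trans (cong (List.foldr _+_ 0ℚ) (map-tabulate id f)) (foldr-tabulate f)

Σ∈ : ∀ {m} → Subset m → (Fin m → ℚ) → ℚ
Σ∈ p f = ∑ (λ i → if lookup p i then f i else 0ℚ)

Σ∈-⊥ : ∀ {m} (f : Fin m → ℚ) → Σ∈ ⊥ f ≡ 0ℚ
Σ∈-⊥ {zero}  f = refl
Σ∈-⊥ {suc m} f = trans (+-identityˡ _) (Σ∈-⊥ (f ∘ suc))

Σ∈-∪⁅⁆ : ∀ {m} (p : Subset m) {i} (f : Fin m → ℚ) → i ∉ p → Σ∈ (p ∪ ⁅ i ⁆) f ≡ Σ∈ p f + f i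
Σ∈-∪⁅⁆ (true  ∷ p) {zero}  f i∉p = ⊥-elim (i∉p here)
Σ∈-∪⁅⁆ (false ∷ p) {zero}  f i∉p = begin
  f zero + Σ∈ (p ∪ ⊥) (f ∘ suc)  ≡⟨ cong (λ q → f zero + Σ∈ q (f ∘ suc)) (∪-identityʳ p) ⟩
  f zero + Σ∈ p (f ∘ suc)        ≡⟨ solve 2 (λ a s → a :+ s := (con 0ℚ :+ s) :+ a) refl (f zero) (Σ∈ p (f ∘ suc)) ⟩
  0ℚ + Σ∈ p (f ∘ suc) + f zero   ∎
  where open ≡-Reasoning
Σ∈-∪⁅⁆ (b ∷ p) {suc i} f i∉p = begin
  (if b ∨ false then f zero else 0ℚ) + Σ∈ (p ∪ ⁅ i ⁆) (f ∘ suc)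
    ≡⟨ cong₂ _+_ (cong (λ b → if b then f zero else 0ℚ) (∨-identityʳ b)) (Σ∈-∪⁅⁆ p (f ∘ suc) (i∉p ∘ there)) ⟩
  a + (Σ∈ p (f ∘ suc) + f (suc i))
    ≡⟨ sym (+-assoc a (Σ∈ p (f ∘ suc)) (f (suc i))) ⟩
  a + Σ∈ p (f ∘ suc) + f (suc i)
    ∎
  where
  open ≡-Reasoning
  a = if b then f zero else 0ℚ

∣p∣*c≤Σ∈ : ∀ {m} (p : Subset m) {c} (f : Fin m → ℚ) → (∀ i → c ≤ f i) → ℕ→ℚ ∣ p ∣ * c ≤ Σ∈ p f
∣p∣*c≤Σ∈ []          {c} f c≤f = ≤-reflexive (*-zeroˡ c)
∣p∣*c≤Σ∈ (true  ∷ p) {c} f c≤f = begin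
  ℕ→ℚ (suc ∣ p ∣) * c   ≡⟨ cong (_* c) (ℕ→ℚ-suc ∣ p ∣) ⟩
  (1ℚ + ℕ→ℚ ∣ p ∣) * c  ≡⟨ solve 2 (λ k c → (con 1ℚ :+ k) :* c := c :+ k :* c) refl (ℕ→ℚ ∣ p ∣) c ⟩
  c + ℕ→ℚ ∣ p ∣ * c     ≤⟨ +-mono-≤ (c≤f zero) (∣p∣*c≤Σ∈ p (f ∘ suc) (c≤f ∘ suc)) ⟩
  f zero + Σ∈ p (f ∘ suc) ∎
  where open ≤-Reasoning
∣p∣*c≤Σ∈ (false ∷ p) {c} f c≤f =
  ≤-trans (∣p∣*c≤Σ∈ p (f ∘ suc) (c≤f ∘ suc)) (≤-reflexive (sym (+-identityˡ _)))

module _ {n m : ℕ} (I : FWSC2 n m) where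
  open FWSC2 I

  weight≡Σ∈ : ∀ X → weight I X ≡ Σ∈ (XA X) wA + Σ∈ (XB X) wB
  weight≡Σ∈ X = cong₂ _+_ (Σfin≡∑ I _) (Σfin≡∑ I _)

  weight-⊥ : weight I ⟨ ⊥ , ⊥ ⟩ ≡ 0ℚ
  weight-⊥ = begin
    weight I ⟨ ⊥ , ⊥ ⟩     ≡⟨ weight≡Σ∈ ⟨ ⊥ , ⊥ ⟩ ⟩
    Σ∈ ⊥ wA + Σ∈ ⊥ wB     ≡⟨ cong₂ _+_ (Σ∈-⊥ wA) (Σ∈-⊥ wB) ⟩
    0ℚ + 0ℚ               ≡⟨ +-identityˡ 0ℚ ⟩
    0ℚ                    ∎
    where open ≡-Reasoning

  weight-∪⁅⁆ : ∀ {XA₀ XB₀ i j} → i ∉ XA₀ → j ∉ XB₀ →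
               weight I ⟨ XA₀ ∪ ⁅ i ⁆ , XB₀ ∪ ⁅ j ⁆ ⟩ ≡ weight I ⟨ XA₀ , XB₀ ⟩ + (wA i + wB j)
  weight-∪⁅⁆ {XA₀} {XB₀} {i} {j} i∉ j∉ = begin
    weight I ⟨ XA₀ ∪ ⁅ i ⁆ , XB₀ ∪ ⁅ j ⁆ ⟩
      ≡⟨ weight≡Σ∈ ⟨ XA₀ ∪ ⁅ i ⁆ , XB₀ ∪ ⁅ j ⁆ ⟩ ⟩
    Σ∈ (XA₀ ∪ ⁅ i ⁆) wA + Σ∈ (XB₀ ∪ ⁅ j ⁆) wB
      ≡⟨ cong₂ _+_ (Σ∈-∪⁅⁆ XA₀ wA i∉) (Σ∈-∪⁅⁆ XB₀ wB j∉) ⟩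
    (Σ∈ XA₀ wA + wA i) + (Σ∈ XB₀ wB + wB j)
      ≡⟨ solve 4 (λ a x b y → (a :+ x) :+ (b :+ y) := (a :+ b) :+ (x :+ y)) refl (Σ∈ XA₀ wA) (wA i) (Σ∈ XB₀ wB) (wB j) ⟩
    (Σ∈ XA₀ wA + Σ∈ XB₀ wB) + (wA i + wB j)
      ≡⟨ cong (_+ (wA i + wB j)) (sym (weight≡Σ∈ ⟨ XA₀ , XB₀ ⟩)) ⟩
    weight I ⟨ XA₀ , XB₀ ⟩ + (wA i + wB j)
      ∎
    where open ≡-Reasoning

  wA∈allWeights : ∀ k → wA k ∈ₗ allWeights I
  wA∈allWeights k = ∈-++⁺ˡ (∈-map⁺ wA (∈-allFin k))

  wB∈allWeights : ∀ k → wB k ∈ₗ allWeights I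
  wB∈allWeights k = ∈-++⁺ʳ (List.map wA (List.allFin m)) (∈-map⁺ wB (∈-allFin k))

  wA≤wmax : ∀ k → wA k ≤ wmax I
  wA≤wmax k = ∈⇒≤foldr-⊔ 0ℚ (allWeights I) (wA∈allWeights k)

  wB≤wmax : ∀ k → wB k ≤ wmax I
  wB≤wmax k = ∈⇒≤foldr-⊔ 0ℚ (allWeights I) (wB∈allWeights k)

  wmin≤wA : ∀ k → wmin I ≤ wA k
  wmin≤wA k = ∈⇒foldr-⊓≤ (wmax I) (allWeights I) (wA∈allWeights k)

  wmin≤wB : ∀ k → wmin I ≤ wB k
  wmin≤wB k = ∈⇒foldr-⊓≤ (wmax I) (allWeights I) (wB∈allWeights k)

  0<wmax : Fin m → 0ℚ < wmax I
  0<wmax k = <-≤-trans (wA-pos k) (wA≤wmax k)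

  0<wmin : Fin m → 0ℚ < wmin I
  0<wmin k = 0<foldr-⊓ (0<wmax k) (All.++⁺ (All.map⁺ (All.tabulate⁺ wA-pos)) (All.map⁺ (All.tabulate⁺ wB-pos)))

  Δ*wmin≡wmax : 0ℚ < wmin I → Δ I * wmin I ≡ wmax I
  Δ*wmin≡wmax = ÷'-*-cancel (wmax I)

  0<Δ : Fin m → 0ℚ < Δ I
  0<Δ k = *-cancelʳ-<-nonNeg (wmin I) {{nonNegative (<⇒≤ (0<wmin k))}}
            (subst₂ _<_ (sym (*-zeroˡ (wmin I))) (sym (Δ*wmin≡wmax (0<wmin k))) (0<wmax k))

  size*wmin≤weight : ∀ X → ℕ→ℚ (size I X) * wmin I ≤ weight I X
  size*wmin≤weight X = begin
    ℕ→ℚ (a ℕ.+ b) * wmin I              ≡⟨ cong (_* wmin I) (ℕ→ℚ-+ a b) ⟩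
    (ℕ→ℚ a + ℕ→ℚ b) * wmin I            ≡⟨ *-distribʳ-+ (wmin I) (ℕ→ℚ a) (ℕ→ℚ b) ⟩
    ℕ→ℚ a * wmin I + ℕ→ℚ b * wmin I     ≤⟨ +-mono-≤ (∣p∣*c≤Σ∈ (XA X) wA wmin≤wA) (∣p∣*c≤Σ∈ (XB X) wB wmin≤wB) ⟩
    Σ∈ (XA X) wA + Σ∈ (XB X) wB         ≡⟨ sym (weight≡Σ∈ X) ⟩
    weight I X                          ∎
    where
    open ≤-Reasoning
    a = ∣ XA X ∣
    b = ∣ XB X ∣

  fair⇒balanced : ∀ X → IsFair I X → ∣ XA X ∣ ≡ ∣ XB X ∣
  fair⇒balanced X (2a≡a+b , _) =
    ℕP.+-cancelˡ-≡ a a b (trans (cong (a ℕ.+_) (sym (ℕP.+-identityʳ a))) 2a≡a+b)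
    where
    a = ∣ XA X ∣
    b = ∣ XB X ∣

  ∣XA∣*[wmax+wmax]≤Δ*weight : Fin m → ∀ X → IsFair I X → ℕ→ℚ ∣ XA X ∣ * (wmax I + wmax I) ≤ Δ I * weight I X
  ∣XA∣*[wmax+wmax]≤Δ*weight k X fair = begin
    ℕ→ℚ a * (wmax I + wmax I)
      ≡⟨ cong (λ w → ℕ→ℚ a * (w + w)) (sym (Δ*wmin≡wmax (0<wmin k))) ⟩
    ℕ→ℚ a * (Δ I * wmin I + Δ I * wmin I)
      ≡⟨ solve 3 (λ a d w → a :* (d :* w :+ d :* w) := d :* ((a :+ a) :* w)) refl (ℕ→ℚ a) (Δ I) (wmin I) ⟩
    Δ I * ((ℕ→ℚ a + ℕ→ℚ a) * wmin I)
      ≡⟨ cong (λ q → Δ I * (q * wmin I)) (sym (ℕ→ℚ-+ a a)) ⟩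
    Δ I * (ℕ→ℚ (a ℕ.+ a) * wmin I)
      ≡⟨ cong (λ b → Δ I * (ℕ→ℚ (a ℕ.+ b) * wmin I)) (fair⇒balanced X fair) ⟩
    Δ I * (ℕ→ℚ (size I X) * wmin I)
      ≤⟨ *-monoˡ-≤-nonNeg (Δ I) {{nonNegative (<⇒≤ (0<Δ k))}} (size*wmin≤weight X) ⟩
    Δ I * weight I X
      ∎
    where
    open ≤-Reasoning
    a = ∣ XA X ∣

  cover⇒0<∣XA∣ : ∀ X → IsCover I X → ∣ XA X ∣ ≡ ∣ XB X ∣ → Fin n → 0 ℕ.< ∣ XA X ∣
  cover⇒0<∣XA∣ X cover balanced x with cover x
  ... | inj₁ (_ , k∈XA , _) = x∈p⇒0<∣p∣ k∈XA
  ... | inj₂ (_ , l∈XB , _) = subst (0 ℕ.<_) (sym balanced) (x∈p⇒0<∣p∣ l∈XB)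

  UsedDisjoint : Subfamily I → Subset n → Set
  UsedDisjoint X U = (∀ {k x} → k ∈ XA X → x ∈ A k → x ∉ U)
                   × (∀ {k x} → k ∈ XB X → x ∈ B k → x ∉ U)

  usedDisjoint-step : ∀ {XA₀ XB₀ U} i j → UsedDisjoint ⟨ XA₀ , XB₀ ⟩ U →
                      UsedDisjoint ⟨ XA₀ ∪ ⁅ i ⁆ , XB₀ ∪ ⁅ j ⁆ ⟩ (U ─ (A i ∪ B j))
  usedDisjoint-step {XA₀} {XB₀} {U} i j (A-disjoint , B-disjoint) = A-disjoint′ , B-disjoint′
    where
    S = A i ∪ B j
    A-disjoint′ : ∀ {k x} → k ∈ XA₀ ∪ ⁅ i ⁆ → x ∈ A k → x ∉ U ─ S
    A-disjoint′ {k} {x} k∈ x∈Ak x∈U─S with x∈p∪q⁻ XA₀ ⁅ i ⁆ k∈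
    ... | inj₁ k∈XA₀ = A-disjoint k∈XA₀ x∈Ak (p─q⊆p U S x∈U─S)
    ... | inj₂ k∈⁅i⁆ = x∈p─q⇒x∉q U S x∈U─S (x∈p∪q⁺ (inj₁ (subst (λ k → x ∈ A k) (x∈⁅y⁆⇒x≡y i k∈⁅i⁆) x∈Ak)))
    B-disjoint′ : ∀ {k x} → k ∈ XB₀ ∪ ⁅ j ⁆ → x ∈ B k → x ∉ U ─ S
    B-disjoint′ {k} {x} k∈ x∈Bk x∈U─S with x∈p∪q⁻ XB₀ ⁅ j ⁆ k∈
    ... | inj₁ k∈XB₀ = B-disjoint k∈XB₀ x∈Bk (p─q⊆p U S x∈U─S)
    ... | inj₂ k∈⁅j⁆ = x∈p─q⇒x∉q U S x∈U─S (x∈p∪q⁺ {p = A i} (inj₂ (subst (λ k → x ∈ B k) (x∈⁅y⁆⇒x≡y j k∈⁅j⁆) x∈Bk)))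

  BestPair : Subset m → Subset m → Subset n → Fin m → Fin m → Set
  BestPair XA₀ XB₀ U i j = ∀ i′ j′ → i′ ∉ XA₀ → j′ ∉ XB₀ →
                           (wA i + wB j) * newCov I U i′ j′ ≤ (wA i′ + wB j′) * newCov I U i j

  module _ (Xopt : Subfamily I) (cover : IsCover I Xopt) (balanced : ∣ XA Xopt ∣ ≡ ∣ XB Xopt ∣) where

    best-pair-bound : ∀ {XA₀ XB₀ U i j} → UsedDisjoint ⟨ XA₀ , XB₀ ⟩ U → i ∉ XA₀ → j ∉ XB₀ →
                      BestPair XA₀ XB₀ U i j →
                      (wA i + wB j) * ℕ→ℚ ∣ U ∣ ≤ ℕ→ℚ ∣ XA Xopt ∣ * (wmax I + wmax I) * newCov I U i j
    best-pair-bound {XA₀} {XB₀} {U} {i} {j} (A-disjoint , B-disjoint) i∉ j∉ best = begin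
      c * ℕ→ℚ ∣ U ∣
        ≤⟨ *-monoˡ-≤-nonNeg c {{nonNegative 0≤c}} (ℕ→ℚ-mono-≤ (union-bound F pairs ⊆-refl covered)) ⟩
      c * ℕ→ℚ (sum (List.map (λ e → ∣ F e ∩ U ∣) pairs))
        ≤⟨ *-sum≤length* c _ _ pairs each ⟩
      ℕ→ℚ (List.length pairs) * (2wmax * d)
        ≡⟨ cong (λ l → ℕ→ℚ l * (2wmax * d)) length-pairs ⟩
      ℕ→ℚ s * (2wmax * d)
        ≡⟨ sym (*-assoc (ℕ→ℚ s) 2wmax d) ⟩
      ℕ→ℚ s * 2wmax * d
        ∎
      where
      open ≤-Reasoning
      s = ∣ XA Xopt ∣
      c = wA i + wB j
      d = newCov I U i j
      2wmax = wmax I + wmax I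
      0≤c : 0ℚ ≤ c
      0≤c = <⇒≤ (+-mono-< (wA-pos i) (wB-pos j))
      pairs : List (Fin m × Fin m)
      pairs = List.zip (elements (XA Xopt)) (elements (XB Xopt))
      F : Fin m × Fin m → Subset n
      F (k , l) = A (replaceIn XA₀ i k) ∪ B (replaceIn XB₀ j l)
      equal-length : List.length (elements (XA Xopt)) ≡ List.length (elements (XB Xopt))
      equal-length = trans (length-elements (XA Xopt)) (trans balanced (sym (length-elements (XB Xopt))))
      length-pairs : List.length pairs ≡ s
      length-pairs = trans (length-zipWith _,_ (elements (XA Xopt)) (elements (XB Xopt)))
                     (trans (cong (List.length (elements (XA Xopt)) ℕ.⊓_) (sym equal-length))
                     (trans (ℕP.⊓-idem (List.length (elements (XA Xopt)))) (length-elements (XA Xopt))))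
      covered : ∀ {x} → x ∈ U → Any (λ e → x ∈ F e) pairs
      covered {x} x∈U with cover x
      ... | inj₁ (k , k∈XA* , x∈Ak) =
        let l , kl∈pairs = ∈-zip⁺ˡ _ _ equal-length (∈-elements (XA Xopt) k∈XA*)
            k-unused = replaceIn-fix {i = i} (λ k∈XA₀ → A-disjoint k∈XA₀ x∈Ak x∈U)
        in lose kl∈pairs (x∈p∪q⁺ (inj₁ (subst (λ k → x ∈ A k) (sym k-unused) x∈Ak)))
      ... | inj₂ (l , l∈XB* , x∈Bl) =
        let k , kl∈pairs = ∈-zip⁺ʳ _ _ equal-length (∈-elements (XB Xopt) l∈XB*)
            l-unused = replaceIn-fix {i = j} (λ l∈XB₀ → B-disjoint l∈XB₀ x∈Bl x∈U)
        in lose kl∈pairs (x∈p∪q⁺ {p = A (replaceIn XA₀ i k)} (inj₂ (subst (λ l → x ∈ B l) (sym l-unused) x∈Bl)))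
      each : ∀ e → c * ℕ→ℚ ∣ F e ∩ U ∣ ≤ 2wmax * d
      each (k , l) = ≤-trans (best k′ l′ (replaceIn-∉ k i∉) (replaceIn-∉ l j∉))
                             (*-monoʳ-≤-nonNeg d {{nonNegative (0≤ℕ→ℚ ∣ (A i ∪ B j) ∩ U ∣)}}
                                               (+-mono-≤ (wA≤wmax k′) (wB≤wmax l′)))
        where
        k′ = replaceIn XA₀ i k
        l′ = replaceIn XB₀ j l

    module _ (D : ℚ) (0≤D : 0ℚ ≤ D) (s*2wmax≤D : ℕ→ℚ ∣ XA Xopt ∣ * (wmax I + wmax I) ≤ D) where

      best-pair-weight≤harmonic-gap :
        ∀ {XA₀ XB₀ U i j} → Nonempty U → UsedDisjoint ⟨ XA₀ , XB₀ ⟩ U → i ∉ XA₀ → j ∉ XB₀ →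
        BestPair XA₀ XB₀ U i j → wA i + wB j ≤ D * (harmonic ∣ U ∣ - harmonic (∣ U ─ (A i ∪ B j) ∣))
      best-pair-weight≤harmonic-gap {XA₀} {XB₀} {U} {i} {j} (_ , x∈U) disjoint i∉ j∉ best =
        *-cancelʳ-≤-pos u {{positive 0<u}} (begin
          (wA i + wB j) * u
            ≤⟨ best-pair-bound disjoint i∉ j∉ best ⟩
          ℕ→ℚ ∣ XA Xopt ∣ * (wmax I + wmax I) * new
            ≤⟨ *-monoʳ-≤-nonNeg new {{nonNegative (0≤ℕ→ℚ ∣ S ∩ U ∣)}} s*2wmax≤D ⟩
          D * new
            ≤⟨ *-monoˡ-≤-nonNeg D {{nonNegative 0≤D}} new≤u*gap ⟩
          D * (u * gap)
            ≡⟨ solve 3 (λ D u g → D :* (u :* g) := D :* g :* u) refl D u gap ⟩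
          D * gap * u
            ∎)
        where
        open ≤-Reasoning
        S = A i ∪ B j
        u = ℕ→ℚ ∣ U ∣
        new = ℕ→ℚ ∣ S ∩ U ∣
        gap = harmonic ∣ U ∣ - harmonic (∣ U ─ S ∣)
        0<u : 0ℚ < u
        0<u = <-≤-trans (0<ℕ→ℚ-suc 0) (ℕ→ℚ-mono-≤ (x∈p⇒0<∣p∣ x∈U))
        new≤u*gap : new ≤ u * gap
        new≤u*gap = subst (λ k → new ≤ ℕ→ℚ k * (harmonic k - harmonic (∣ U ─ S ∣)))
                          (∣q∩p∣+∣p─q∣≡∣p∣ U S) (harmonic-gap ∣ S ∩ U ∣ ∣ U ─ S ∣)

      Invariant : State I → Set
      Invariant (st X U) = UsedDisjoint X U × (weight I X + D * harmonic ∣ U ∣ ≤ D * harmonic n)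

      step-preserves : ∀ {s t} → Step I s t → Invariant s → Invariant t
      step-preserves (step XA₀ XB₀ U i j U≢∅ i∉ j∉ best) (disjoint , potential≤) =
        usedDisjoint-step i j disjoint , (begin
          weight I ⟨ XA₀ ∪ ⁅ i ⁆ , XB₀ ∪ ⁅ j ⁆ ⟩ + D * H′
            ≡⟨ cong (_+ D * H′) (weight-∪⁅⁆ i∉ j∉) ⟩
          w₀ + (wA i + wB j) + D * H′
            ≤⟨ +-monoˡ-≤ (D * H′) (+-monoʳ-≤ w₀ (best-pair-weight≤harmonic-gap U≢∅ disjoint i∉ j∉ best)) ⟩
          w₀ + D * (H - H′) + D * H′
            ≡⟨ solve 4 (λ w D a b → w :+ D :* (a :- b) :+ D :* b := w :+ D :* a) refl w₀ D H H′ ⟩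
          w₀ + D * H
            ≤⟨ potential≤ ⟩
          D * harmonic n
            ∎)
        where
        open ≤-Reasoning
        w₀ = weight I ⟨ XA₀ , XB₀ ⟩
        H = harmonic ∣ U ∣
        H′ = harmonic ∣ U ─ (A i ∪ B j) ∣

      steps-preserve : ∀ {s t} → Steps I s t → Invariant s → Invariant t
      steps-preserve (done _)          inv = inv
      steps-preserve (more first rest) inv = steps-preserve rest (step-preserves first inv)

      greedy-weight≤D*harmonic : ∀ Xw → GreedyOutput I Xw → weight I Xw ≤ D * harmonic n
      greedy-weight≤D*harmonic Xw (U , steps , U-empty) = begin
        weight I Xw                       ≡⟨ sym (+-identityʳ _) ⟩
        weight I Xw + 0ℚ                  ≡⟨ cong (λ q → weight I Xw + q) (sym (*-zeroʳ D)) ⟩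
        weight I Xw + D * 0ℚ              ≡⟨ cong (λ k → weight I Xw + D * harmonic k) (sym (Empty⇒∣p∣≡0 U-empty)) ⟩
        weight I Xw + D * harmonic ∣ U ∣   ≤⟨ proj₂ (steps-preserve steps initial) ⟩
        D * harmonic n                    ∎
        where
        open ≤-Reasoning
        initial : Invariant (st ⟨ ⊥ , ⊥ ⟩ ⊤)
        initial = ((λ k∈⊥ _ _ → ∉⊥ k∈⊥) , (λ k∈⊥ _ _ → ∉⊥ k∈⊥))
                , ≤-reflexive (trans (cong₂ (λ w k → w + D * harmonic k) weight-⊥ (∣⊤∣≡n n)) (+-identityˡ _))

greedy-ratio≤harmonic : ∀ {n m} (I : FWSC2 (suc n) m) (Xopt : Subfamily I) → IsOptFairCover I Xopt →
                        ∀ Xw → GreedyOutput I Xw → weight I Xw ÷' (Δ I * weight I Xopt) ≤ harmonic (suc n)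
greedy-ratio≤harmonic I Xopt ((cover , fair) , _) Xw greedy =
  ÷'-≤ 0<D (greedy-weight≤D*harmonic I Xopt cover balanced D (<⇒≤ 0<D) s*2wmax≤D Xw greedy)
  where
  D = Δ I * weight I Xopt
  balanced = fair⇒balanced I Xopt fair
  k = [ proj₁ , proj₁ ]′ (FWSC2.union-U I zero)
  s*2wmax≤D = ∣XA∣*[wmax+wmax]≤Δ*weight I k Xopt fair
  0<2wmax : 0ℚ < wmax I + wmax I
  0<2wmax = +-mono-< (0<wmax I k) (0<wmax I k)
  0<D : 0ℚ < D
  0<D = <-≤-trans 0<2wmax
          (≤-trans (p≤ℕ→ℚ[k]*p (cover⇒0<∣XA∣ I Xopt cover balanced zero) (<⇒≤ 0<2wmax)) s*2wmax≤D)

lemmaA1 : Σ ℚ λ c → 0ℚ < c ×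
    (∀ (n m : ℕ) (I : FWSC2 n m) → 1 Data.Nat.≤ n →
      ∀ (Xopt : Subfamily I) → IsOptFairCover I Xopt →
      LnLe n (ℕ→ℚ m ÷' ((c * Δ I) * (ℕ→ℚ (size I Xopt) ÷' ℕ→ℚ 2))) →
      ∀ (Xw : Subfamily I) → GreedyOutput I Xw →
      LeLn ((weight I Xw ÷' (Δ I * weight I Xopt)) - 1ℚ) n)
lemmaA1 = 1ℚ , positive⁻¹ 1ℚ , λ where
  (suc n) m I _ Xopt opt _ Xw greedy →
    ≤harmonic-1⇒LeLn n (+-monoˡ-≤ (- 1ℚ) (greedy-ratio≤harmonic I Xopt opt Xw greedy))
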